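{- Let $\mathcal M=(W,E,V)$ be a playable coalition model, $w\in W$, $C\subseteq N$, and $s\in\{0,1\}^2$. Then the fiber $(\nu_C^w)^{ -1}(s)=\{X\subseteq W\mid\nu_C^w(X)=s\}$ is order-convex in $(\mathcal P(W),\subseteq)$: whenever $X\subseteq Y\subseteq Z$ and $X,Z$ belong to it, so does $Y$.
   Context: Let $N=\{1,\dots,n\}$ be a finite set of agents. A coalition model is $\mathcal M=(W,E,V)$ with $W\ne\emptyset$, $E$ assigning to each $w\in W$ and $C\subseteq N$ a family $E_w(C)\subseteq\mathcal P(W)$, and a valuation $V$. For $X\subseteq W$, $\overline X=W\setminus X$. $E_w$ is playable if: (i) $\emptyset\notin E_w(C)$ for all $C$; (ii) $W\in E_w(C)$ for all $C$; (iii) if $X\in E_w(C)$ and $X\subseteq Y\subseteq W$ then $Y\in E_w(C)$; (iv) if $C\cap D=\emptyset$, $X\in E_w(C)$, $Y\in E_w(D)$ then $X\cap Y\in E_w(C\cup D)$; (v) for every $X$, $X\notin E_w(\emptyset)$ iff $\overline X\in E_w(N)$. The model is playable if every $E_w$ is. Strategic value: $\nu_C^w(X):=(a,b)\in\{0,1\}^2$ with $a=1$ iff $X\in E_w(C)$ and $b=1$ iff $\overline X\in E_w(C)$; the four values $(1,1),(1,0),(0,1),(0,0)$ are called $\mathrm{FC},\mathrm{PD},\mathrm{AD},\mathrm{FI}$ respectively. -}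

module Defs where

open import Level using (0ℓ)
open import Data.Nat using (ℕ)
open import Data.Bool using (Bool; true; false)
open import Data.Product using (_×_; _,_)
open import Relation.Nullary using (¬_)
open import Relation.Binary.PropositionalEquality using (_≡_)
open import Function.Bundles using (_⇔_)
open import Relation.Unary using (Pred; _⊆_; ∁) renaming (∅ to ∅ₚ; U to Uₚ; _∩_ to _∩ₚ_)
import Data.Fin.Subset as FS

Coalition : ℕ → Set
Coalition n = FS.Subset n

record CoalitionModel (n : ℕ) (Atom : Set) : Set₁ where
  field
    W        : Set
    nonempty : W
    E        : W → Coalition n → Pred (Pred W 0ℓ) 0ℓ
    V        : Atom → Pred W 0ℓ

record PlayableAt {n : ℕ} {Atom : Set} (M : CoalitionModel n Atom)
                  (w : CoalitionModel.W M) : Set₁ where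
  open CoalitionModel M
  field
    no-empty   : ∀ C → ¬ E w C ∅ₚ
    has-full   : ∀ C → E w C Uₚ
    monotone   : ∀ C (X Y : Pred W 0ℓ) → E w C X → X ⊆ Y → E w C Y
    superadd   : ∀ C D (X Y : Pred W 0ℓ) → C FS.∩ D ≡ FS.⊥ →
                 E w C X → E w D Y → E w (C FS.∪ D) (X ∩ₚ Y)
    determined : ∀ (X : Pred W 0ℓ) → (¬ E w FS.⊥ X) ⇔ E w FS.⊤ (∁ X)

Playable : {n : ℕ} {Atom : Set} → CoalitionModel n Atom → Set₁
Playable M = ∀ w → PlayableAt M w

-- Bool pairs encode {0,1}^2 (true = 1).
-- Since membership is not decidable constructively, ν is given by its graph:
-- HasValue M w C X s  means  ν_C^w(X) = s.
HasValue : {n : ℕ} {Atom : Set} (M : CoalitionModel n Atom) →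
           CoalitionModel.W M → Coalition n →
           Pred (CoalitionModel.W M) 0ℓ → Bool × Bool → Set
HasValue M w C X (a , b) =
  ((a ≡ true) ⇔ CoalitionModel.E M w C X) ×
  ((b ≡ true) ⇔ CoalitionModel.E M w C (∁ X))

module Submission where

open import Defs
open import Level using (0ℓ)
open import Data.Nat using (ℕ)
open import Data.Bool using (Bool; true; false)
open import Data.Product using (_×_; _,_)
open import Relation.Unary using (Pred; _⊆_; ∁)
open import Relation.Binary.PropositionalEquality using (_≡_; refl)
open import Function.Bundles using (_⇔_; mk⇔; Equivalence)

-- Only monotonicity (iii) is used.  Each coordinate of ν is the indicator of
-- an upward-closed family, whose fibers are convex; the second coordinate
-- reads X through the order-reversing complement.

UpwardClosed : {A : Set} → Pred (Pred A 0ℓ) 0ℓ → Set₁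
UpwardClosed {A} F = ∀ (X Y : Pred A 0ℓ) → F X → X ⊆ Y → F Y

indicator-fiber-convex : {A : Set} {F : Pred (Pred A 0ℓ) 0ℓ} → UpwardClosed F →
                         (a : Bool) (X Y Z : Pred A 0ℓ) → X ⊆ Y → Y ⊆ Z →
                         ((a ≡ true) ⇔ F X) → ((a ≡ true) ⇔ F Z) →
                         ((a ≡ true) ⇔ F Y)
indicator-fiber-convex up true  X Y Z X⊆Y Y⊆Z FX _ =
  mk⇔ (λ _ → up X Y (Equivalence.to FX refl) X⊆Y) (λ _ → refl)
indicator-fiber-convex up false X Y Z X⊆Y Y⊆Z _ FZ =
  mk⇔ (λ ()) (λ FY → Equivalence.from FZ (up Y Z FY Y⊆Z))

∁-antitone : {A : Set} (X Y : Pred A 0ℓ) → X ⊆ Y → ∁ Y ⊆ ∁ X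
∁-antitone X Y X⊆Y ¬Yx Xx = ¬Yx (X⊆Y Xx)

corollary6p4 : {n : ℕ} {Atom : Set} (M : CoalitionModel n Atom) → Playable M →
               (w : CoalitionModel.W M) (C : Coalition n) (s : Bool × Bool) →
               (X Y Z : Pred (CoalitionModel.W M) 0ℓ) →
               X ⊆ Y → Y ⊆ Z → HasValue M w C X s → HasValue M w C Z s →
               HasValue M w C Y s
corollary6p4 M playable w C (a , b) X Y Z X⊆Y Y⊆Z (aX , bX) (aZ , bZ) =
  indicator-fiber-convex up a X Y Z X⊆Y Y⊆Z aX aZ ,
  indicator-fiber-convex up b (∁ Z) (∁ Y) (∁ X) (∁-antitone Y Z Y⊆Z) (∁-antitone X Y X⊆Y) bZ bX
  where
  up : UpwardClosed (CoalitionModel.E M w C)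
  up = PlayableAt.monotone (playable w) C
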